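{- Let $W=(w_{ij})$ be a weighing matrix of order $n$, and let $\mathcal{D}(W)$ be the square incidence structure defined by $W$. Let $\tau_0=(1,-1)(2,-2)\cdots(n,-n)$. Suppose that every fixed-point-free involutive automorphism $\tau$ of $\mathcal{D}(W)$ satisfying conditions (i) and (ii) below is conjugate to $\tau_0$ in $\mathrm{Aut}(\mathcal{D}(W))$. If $U$ is a weighing matrix of order $n$ such that $\mathcal{D}(U)$ is equivalent to $\mathcal{D}(W)$, then $U$ is equivalent to $W$. The conditions on a fixed-point-free involutive permutation $\tau$ of $\mathcal{P}$, with orbits $P_1,\dots,P_n$ on $\mathcal{P}$, are: (i) $|B\cap P_i|\le 1$ for every $i$ ($1\le i\le n$) and every block $B\in\mathcal{B}(W)$; (ii) for any two blocks $B,B'\in\mathcal{B}(W)$ with $B'\ne B$ and $B'\neq B^\tau$, $|\{i : B\cap P_i=B'\cap P_i\neq\emptyset\}| = |\{i : \emptyset\neq B\cap P_i\neq B'\cap P_i\neq\emptyset\}|$.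
   Context: A weighing matrix of order $n$ and weight $k$ is an $n\times n$ matrix with entries in $\{1,-1,0\}$ such that $WW^T=kI_n$. Two weighing matrices $W_1,W_2$ of order $n$ are equivalent if $W_1=PW_2Q$ for some $n\times n$ monomial matrices $P,Q$ with nonzero entries in $\{1,-1\}$. For a weighing matrix $W=(w_{ij})$ of order $n$, the incidence structure $\mathcal{D}(W)$ has point set $\mathcal{P}=\{\pm1,\pm2,\dots,\pm n\}$ and block set $\mathcal{B}(W)=\{B_i^\varepsilon : 1\le i\le n,\ \varepsilon=\pm1\}$, where $B_i^\varepsilon=\{\varepsilon w_{ij}\, j : 1\le j\le n,\ w_{ij}\neq 0\}$. An automorphism of $\mathcal{D}(W)$ is a permutation of $\mathcal{P}$ mapping $\mathcal{B}(W)$ onto $\mathcal{B}(W)$; these form the group $\mathrm{Aut}(\mathcal{D}(W))$. $\mathcal{D}(W_1)$ and $\mathcal{D}(W_2)$ are equivalent if some permutation of $\mathcal{P}$ maps $\mathcal{B}(W_1)$ onto $\mathcal{B}(W_2)$. For a block $B$ and permutation $\tau$, $B^\tau$ denotes the image of $B$ under $\tau$. -}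

module Defs where

open import Data.Nat as ℕ using (ℕ; zero; suc; _≤_; _/_)
open import Data.Integer as ℤ using (ℤ; +_; -[1+_]; _*_; _+_; 0ℤ; 1ℤ; -1ℤ)
open import Data.Fin using (Fin; zero; suc)
import Data.Fin as Fin
open import Data.Sign as Sign using (Sign; opposite)
open import Data.Bool using (Bool; true; false; _∧_; _∨_; not; if_then_else_)
open import Data.Product using (_×_; _,_; ∃; Σ; proj₁; proj₂)
open import Data.Sum using (_⊎_)
open import Data.Nat.ListAction using (sum)
open import Data.List using (List; []; _∷_; _++_; map; concatMap; allFin)
open import Relation.Binary.PropositionalEquality using (_≡_; _≢_)
open import Relation.Nullary using (¬_)
open import Relation.Nullary.Decidable using (⌊_⌋)
open import Function.Bundles using (_↔_; Inverse)

Mat : ℕ → Set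
Mat n = Fin n → Fin n → ℤ

sumℤ : ∀ {n} → (Fin n → ℤ) → ℤ
sumℤ {zero}  f = 0ℤ
sumℤ {suc n} f = f zero + sumℤ (λ i → f (suc i))

_·_ : ∀ {n} → Mat n → Mat n → Mat n
(A · B) i j = sumℤ (λ l → A i l * B l j)

_ᵀ : ∀ {n} → Mat n → Mat n
(A ᵀ) i j = A j i

δ : ∀ {n} → Mat n
δ i j = if ⌊ i Fin.≟ j ⌋ then 1ℤ else 0ℤ

Ternary : ℤ → Set
Ternary x = x ≡ 0ℤ ⊎ x ≡ 1ℤ ⊎ x ≡ -1ℤ

IsWeighing : (n k : ℕ) → Mat n → Set
IsWeighing n k W =
  (∀ i j → Ternary (W i j)) × (∀ i j → (W · (W ᵀ)) i j ≡ (+ k) * δ i j)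

IsSignedMonomial : ∀ {n} → Mat n → Set
IsSignedMonomial {n} M =
  (∀ i j → Ternary (M i j))
  × (∀ i → ∃ λ j → M i j ≢ 0ℤ × (∀ j′ → M i j′ ≢ 0ℤ → j′ ≡ j))
  × (∀ j → ∃ λ i → M i j ≢ 0ℤ × (∀ i′ → M i′ j ≢ 0ℤ → i′ ≡ i))

MatEquiv : ∀ {n} → Mat n → Mat n → Set
MatEquiv {n} W₁ W₂ = Σ (Mat n) λ P → Σ (Mat n) λ Q →
  IsSignedMonomial P × IsSignedMonomial Q × (∀ i j → W₁ i j ≡ ((P · W₂) · Q) i j)

-- the point s·j  (s ∈ {+,-}, j ∈ {1..n}); P = {±1,…,±n}
Pt : ℕ → Set
Pt n = Sign × Fin n

allPts : ∀ n → List (Pt n)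
allPts n = map (Sign.+ ,_) (allFin n) ++ map (Sign.- ,_) (allFin n)

sgnℤ : Sign → ℤ
sgnℤ Sign.+ = 1ℤ
sgnℤ Sign.- = -1ℤ

BIdx : ℕ → Set
BIdx n = Fin n × Sign

Blk : ℕ → Set
Blk n = Pt n → Bool

-- B_i^ε = { ε w_ij j : w_ij ≠ 0 }; the point s·j lies in it iff ε w_ij = s
block : ∀ {n} → Mat n → BIdx n → Blk n
block W (i , ε) (s , j) = ⌊ sgnℤ ε * W i j ℤ.≟ sgnℤ s ⌋

_≐_ : ∀ {n} → Blk n → Blk n → Set
B ≐ B′ = ∀ p → B p ≡ B′ p

Perm : ℕ → Set
Perm n = Pt n ↔ Pt n

_^_ : ∀ {n} → Blk n → Perm n → Blk n
(B ^ σ) p = B (Inverse.from σ p)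

MapsOnto : ∀ {n} → Perm n → Mat n → Mat n → Set
MapsOnto σ U W =
  (∀ b → ∃ λ b′ → (block U b ^ σ) ≐ block W b′)
  × (∀ b′ → ∃ λ b → (block U b ^ σ) ≐ block W b′)

IsAut : ∀ {n} → Mat n → Perm n → Set
IsAut W σ = MapsOnto σ W W

DEquiv : ∀ {n} → Mat n → Mat n → Set
DEquiv {n} U W = ∃ λ (σ : Perm n) → MapsOnto σ U W

FixedPointFreeInvolution : ∀ {n} → Perm n → Set
FixedPointFreeInvolution τ =
  (∀ p → Inverse.to τ (Inverse.to τ p) ≡ p) × (∀ p → Inverse.to τ p ≢ p)

τ₀fun : ∀ {n} → Pt n → Pt n
τ₀fun (s , j) = (opposite s , j)

b2n : Bool → ℕ
b2n true = 1
b2n false = 0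

countPts : ∀ {n} → (Pt n → Bool) → ℕ
countPts {n} f = sum (map (λ p → b2n (f p)) (allPts n))

-- The orbit of p under τ is {p, τ p}.
-- (i): |B ∩ P_i| ≤ 1 for every orbit P_i and every block B ∈ B(W)
CondI : ∀ {n} → Mat n → Perm n → Set
CondI W τ = ∀ b p → b2n (block W b p) ℕ.+ b2n (block W b (Inverse.to τ p)) ≤ 1

beq : Bool → Bool → Bool
beq true true = true
beq false false = true
beq _ _ = false

sameNonempty : ∀ {n} → Blk n → Blk n → Pt n → Pt n → Bool
sameNonempty B B′ p q =
  beq (B p) (B′ p) ∧ beq (B q) (B′ q) ∧ (B p ∨ B q)

diffNonempty : ∀ {n} → Blk n → Blk n → Pt n → Pt n → Bool
diffNonempty B B′ p q =
  (B p ∨ B q) ∧ not (beq (B p) (B′ p) ∧ beq (B q) (B′ q)) ∧ (B′ p ∨ B′ q)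

-- number of orbits {p, τ p} of τ satisfying a (symmetric) property φ:
-- every orbit of a fixed-point-free involution contains exactly two points,
-- so the number of orbits is half the number of points whose orbit has φ
orbitCount : ∀ {n} → Perm n → (Pt n → Pt n → Bool) → ℕ
orbitCount τ φ = countPts (λ p → φ p (Inverse.to τ p)) / 2

CondII : ∀ {n} → Mat n → Perm n → Set
CondII W τ = ∀ b b′ →
  ¬ (block W b′ ≐ block W b) → ¬ (block W b′ ≐ (block W b ^ τ)) →
  orbitCount τ (sameNonempty (block W b) (block W b′))
    ≡ orbitCount τ (diffNonempty (block W b) (block W b′))

ConjugateToτ₀ : ∀ {n} → Mat n → Perm n → Set
ConjugateToτ₀ {n} W τ = ∃ λ (σ : Perm n) → IsAut W σ ×
  (∀ p → Inverse.to τ p ≡ Inverse.to σ (τ₀fun (Inverse.from σ p)))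

module Submission where

-- Let σ : D(U) → D(W) be an equivalence.  The involution τ₀ flips every block
-- B_i^ε of D(U) to B_i^{-ε}, so it is a fixed-point-free involutive automorphism of D(U)
-- satisfying (i) (an entry is never both 1 and -1) and (ii) (for blocks of distinct rows
-- i, i' the two orbit counts are the numbers of columns where u_ij u_i'j is 1 resp. -1,
-- which agree because the rows are orthogonal).  All four properties transport along σ,
-- so τ = σ τ₀ σ⁻¹ satisfies the hypothesis and τ = ρ τ₀ ρ⁻¹ for some ρ ∈ Aut(D(W)).
-- Then π = ρ⁻¹ σ is again an equivalence D(U) → D(W) and it commutes with τ₀, so it
-- acts as (s , j) ↦ (s t_j , h(j)) on points.  Reading off where π sends the block
-- B_i^+ gives u_ij = e_i w_{r(i) h(j)} t_j; h is injective since π is, r is injective by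
-- orthogonality of the rows of U, and both are onto by pigeonhole.  Hence U = P W Q for
-- signed permutation matrices P, Q.  If U has weight 0, then U = W = 0 and P = Q = I.

open import Defs
open import Data.Nat as ℕ using (ℕ; zero; suc)
import Data.Nat.Properties as ℕP
open import Data.Integer as ℤ using (ℤ; +_; _*_; _+_; 0ℤ; 1ℤ; -1ℤ)
import Data.Integer.Properties as ℤP
open import Data.Integer.Tactic.RingSolver using (solve-∀)
open import Data.Fin as Fin using (Fin; zero; suc; _↑ˡ_; _↑ʳ_)
import Data.Fin.Properties as FinP
open import Data.Sign as Sign using (Sign; opposite)
import Data.Sign.Properties as SignP
open import Data.Bool using (Bool; true; false; _∧_; _∨_; not; if_then_else_)
open import Data.Product using (_×_; _,_; ∃; proj₁; proj₂)
open import Data.Sum using (_⊎_; inj₁; inj₂; [_,_]′)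
open import Data.List using (map; allFin; tabulate; _++_)
import Data.List.Properties as ListP
open import Data.Nat.ListAction using (sum)
open import Data.Nat.ListAction.Properties using (sum-++)
open import Function using (_∘_; id)
open import Function.Bundles using (_↔_; Inverse; mk↔ₛ′)
open import Function.Definitions using (Injective)
open import Function.Properties.Inverse using (↔-sym; ↔-trans)
open import Relation.Binary.PropositionalEquality
open import Relation.Nullary using (¬_; Dec; yes; no; contradiction)
open import Relation.Nullary.Decidable using (⌊_⌋)
import Algebra.Properties.CommutativeMonoid.Sum as MonoidSum
import Algebra.Properties.Semiring.Sum as SemiringSum

open ≡-Reasoning
open Inverse using (to; from; strictlyInverseˡ; strictlyInverseʳ)

module NatSum = MonoidSum ℕP.+-0-commutativeMonoid
module IntSum = SemiringSum ℤP.+-*-semiring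

pattern is0  = inj₁ refl
pattern is+1 = inj₂ (inj₁ refl)
pattern is-1 = inj₂ (inj₂ refl)


sgnℤ-* : ∀ s t → sgnℤ (s Sign.* t) ≡ sgnℤ s * sgnℤ t
sgnℤ-* Sign.+ Sign.+ = refl
sgnℤ-* Sign.+ Sign.- = refl
sgnℤ-* Sign.- Sign.+ = refl
sgnℤ-* Sign.- Sign.- = refl

sgnℤ-opposite : ∀ s → sgnℤ (opposite s) ≡ ℤ.- sgnℤ s
sgnℤ-opposite Sign.+ = refl
sgnℤ-opposite Sign.- = refl

sgnℤ² : ∀ s → sgnℤ s * sgnℤ s ≡ 1ℤ
sgnℤ² Sign.+ = refl
sgnℤ² Sign.- = refl

sgn-cancelˡ : ∀ s x → sgnℤ s * (sgnℤ s * x) ≡ x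
sgn-cancelˡ s x = begin
  sgnℤ s * (sgnℤ s * x)  ≡⟨ ℤP.*-assoc (sgnℤ s) (sgnℤ s) x ⟨
  sgnℤ s * sgnℤ s * x    ≡⟨ cong (_* x) (sgnℤ² s) ⟩
  1ℤ * x                 ≡⟨ ℤP.*-identityˡ x ⟩
  x                      ∎

sgn-cancelʳ : ∀ x s → x * sgnℤ s * sgnℤ s ≡ x
sgn-cancelʳ x s = begin
  x * sgnℤ s * sgnℤ s    ≡⟨ ℤP.*-assoc x (sgnℤ s) (sgnℤ s) ⟩
  x * (sgnℤ s * sgnℤ s)  ≡⟨ cong (x *_) (sgnℤ² s) ⟩
  x * 1ℤ                 ≡⟨ ℤP.*-identityʳ x ⟩
  x                      ∎

unsign : ∀ {x y z} e → x ≡ sgnℤ e * y * z → sgnℤ e * x ≡ y * z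
unsign {x} {y} {z} e eq = begin
  sgnℤ e * x                   ≡⟨ cong (sgnℤ e *_) eq ⟩
  sgnℤ e * (sgnℤ e * y * z)    ≡⟨ cong (sgnℤ e *_) (ℤP.*-assoc (sgnℤ e) y z) ⟩
  sgnℤ e * (sgnℤ e * (y * z))  ≡⟨ sgn-cancelˡ e (y * z) ⟩
  y * z                        ∎

sign-dichotomy : ∀ s t → t ≡ s ⊎ t ≡ opposite s
sign-dichotomy Sign.+ Sign.+ = inj₁ refl
sign-dichotomy Sign.+ Sign.- = inj₂ refl
sign-dichotomy Sign.- Sign.+ = inj₂ refl
sign-dichotomy Sign.- Sign.- = inj₁ refl

sgnℤ-ternary : ∀ s → Ternary (sgnℤ s)
sgnℤ-ternary Sign.+ = is+1
sgnℤ-ternary Sign.- = is-1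

ternary-* : ∀ {x y} → Ternary x → Ternary y → Ternary (x * y)
ternary-* is0  _    = is0
ternary-* is+1 is0  = is0
ternary-* is+1 is+1 = is+1
ternary-* is+1 is-1 = is-1
ternary-* is-1 is0  = is0
ternary-* is-1 is+1 = is-1
ternary-* is-1 is-1 = is+1

-- The point s·j lies in the block B_i^ε of D(X) iff ε x_ij = s, i.e. iff
-- hits (sgnℤ ε * X i j) s; this is definitionally  block X (i , ε) (s , j).

hits : ℤ → Sign → Bool
hits x s = ⌊ x ℤ.≟ sgnℤ s ⌋

⌊⌋-cong : ∀ {A B : Set} (a? : Dec A) (b? : Dec B) → (A → B) → (B → A) → ⌊ a? ⌋ ≡ ⌊ b? ⌋
⌊⌋-cong (yes _) (yes _) _ _ = refl
⌊⌋-cong (yes a) (no ¬b) f _ = contradiction (f a) ¬b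
⌊⌋-cong (no ¬a) (yes b) _ g = contradiction (g b) ¬a
⌊⌋-cong (no _)  (no _)  _ _ = refl

hits-shift : ∀ x s t → hits x (s Sign.* t) ≡ hits (x * sgnℤ t) s
hits-shift x s t = ⌊⌋-cong (x ℤ.≟ _) (_ ℤ.≟ _) forward backward
  where
  forward : x ≡ sgnℤ (s Sign.* t) → x * sgnℤ t ≡ sgnℤ s
  forward refl = trans (cong (_* sgnℤ t) (sgnℤ-* s t)) (sgn-cancelʳ (sgnℤ s) t)
  backward : x * sgnℤ t ≡ sgnℤ s → x ≡ sgnℤ (s Sign.* t)
  backward eq = begin
    x                    ≡⟨ sgn-cancelʳ x t ⟨
    x * sgnℤ t * sgnℤ t  ≡⟨ cong (_* sgnℤ t) eq ⟩
    sgnℤ s * sgnℤ t      ≡⟨ sgnℤ-* s t ⟨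
    sgnℤ (s Sign.* t)    ∎

hits-opposite : ∀ x s → hits x (opposite s) ≡ hits (ℤ.- x) s
hits-opposite x s = ⌊⌋-cong (x ℤ.≟ _) (_ ℤ.≟ _) forward backward
  where
  forward : x ≡ sgnℤ (opposite s) → ℤ.- x ≡ sgnℤ s
  forward refl = trans (cong ℤ.-_ (sgnℤ-opposite s)) (ℤP.neg-involutive (sgnℤ s))
  backward : ℤ.- x ≡ sgnℤ s → x ≡ sgnℤ (opposite s)
  backward eq = trans (sym (ℤP.neg-involutive x)) (trans (cong ℤ.-_ eq) (sym (sgnℤ-opposite s)))

hits-exclusive : ∀ x s → b2n (hits x s) ℕ.+ b2n (hits x (opposite s)) ℕ.≤ 1
hits-exclusive x s with x ℤ.≟ sgnℤ s
hits-exclusive _ Sign.+ | yes refl = ℕP.≤-refl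
hits-exclusive _ Sign.- | yes refl = ℕP.≤-refl
hits-exclusive x s      | no _     = b2n≤1 (hits x (opposite s))
  where
  b2n≤1 : ∀ b → b2n b ℕ.≤ 1
  b2n≤1 true  = ℕP.≤-refl
  b2n≤1 false = ℕ.z≤n

hits-determines : ∀ {x y} → Ternary x → Ternary y → (∀ s → hits x s ≡ hits y s) → x ≡ y
hits-determines is0  is0  _ = refl
hits-determines is+1 is+1 _ = refl
hits-determines is-1 is-1 _ = refl
hits-determines is0  is+1 h = contradiction (h Sign.+) λ ()
hits-determines is0  is-1 h = contradiction (h Sign.-) λ ()
hits-determines is+1 is0  h = contradiction (h Sign.+) λ ()
hits-determines is+1 is-1 h = contradiction (h Sign.+) λ ()
hits-determines is-1 is0  h = contradiction (h Sign.-) λ ()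
hits-determines is-1 is+1 h = contradiction (h Sign.+) λ ()

block-τ₀ : ∀ {n} (X : Mat n) i ε q → block X (i , ε) (τ₀fun q) ≡ block X (i , opposite ε) q
block-τ₀ X i ε (s , j) = begin
  hits (sgnℤ ε * X i j) (opposite s)        ≡⟨ hits-opposite (sgnℤ ε * X i j) s ⟩
  hits (ℤ.- (sgnℤ ε * X i j)) s             ≡⟨ cong (λ x → hits x s) (ℤP.neg-distribˡ-* (sgnℤ ε) (X i j)) ⟩
  hits (ℤ.- sgnℤ ε * X i j) s               ≡⟨ cong (λ x → hits (x * X i j) s) (sgnℤ-opposite ε) ⟨
  hits (sgnℤ (opposite ε) * X i j) s        ∎

τ₀fun-involutive : ∀ {n} (q : Pt n) → τ₀fun (τ₀fun q) ≡ q
τ₀fun-involutive (s , j) = cong (_, j) (SignP.opposite-involutive s)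

τ₀ : ∀ {n} → Perm n
τ₀ = mk↔ₛ′ τ₀fun τ₀fun τ₀fun-involutive τ₀fun-involutive

same-row-blocks : ∀ {n} (X : Mat n) i ε ε′ →
  block X (i , ε′) ≐ block X (i , ε) ⊎ block X (i , ε′) ≐ (block X (i , ε) ^ τ₀)
same-row-blocks X i ε ε′ with sign-dichotomy ε ε′
... | inj₁ refl = inj₁ (λ _ → refl)
... | inj₂ refl = inj₂ (λ p → sym (block-τ₀ X i ε p))


-- Defs counts with list sums; the library's lemmas are about vector sums.
sum-tabulate : ∀ {m} (g : Fin m → ℕ) → sum (tabulate g) ≡ NatSum.sum g
sum-tabulate {zero}  g = refl
sum-tabulate {suc m} g = cong (g zero ℕ.+_) (sum-tabulate (g ∘ suc))

countPts-split : ∀ {n} (f : Pt n → Bool) →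
  countPts f ≡ NatSum.sum (λ j → b2n (f (Sign.+ , j))) ℕ.+ NatSum.sum (λ j → b2n (f (Sign.- , j)))
countPts-split {n} f = begin
  sum (map g (map (Sign.+ ,_) (allFin n) ++ map (Sign.- ,_) (allFin n)))
    ≡⟨ cong sum (ListP.map-++ g (map (Sign.+ ,_) (allFin n)) _) ⟩
  sum (map g (map (Sign.+ ,_) (allFin n)) ++ map g (map (Sign.- ,_) (allFin n)))
    ≡⟨ sum-++ (map g (map (Sign.+ ,_) (allFin n))) _ ⟩
  sum (map g (map (Sign.+ ,_) (allFin n))) ℕ.+ sum (map g (map (Sign.- ,_) (allFin n)))
    ≡⟨ cong₂ ℕ._+_ (half Sign.+) (half Sign.-) ⟩
  NatSum.sum (λ j → g (Sign.+ , j)) ℕ.+ NatSum.sum (λ j → g (Sign.- , j))  ∎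
  where
  g : Pt n → ℕ
  g p = b2n (f p)
  half : ∀ s → sum (map g (map (s ,_) (allFin n))) ≡ NatSum.sum (λ j → g (s , j))
  half s = begin
    sum (map g (map (s ,_) (allFin n)))  ≡⟨ cong (sum ∘ map g) (ListP.map-tabulate id (s ,_)) ⟩
    sum (map g (tabulate (s ,_)))        ≡⟨ cong sum (ListP.map-tabulate (s ,_) g) ⟩
    sum (tabulate (λ j → g (s , j)))     ≡⟨ sum-tabulate (λ j → g (s , j)) ⟩
    NatSum.sum (λ j → g (s , j))         ∎

countPts-cong : ∀ {n} {f g : Pt n → Bool} → (∀ p → f p ≡ g p) → countPts f ≡ countPts g
countPts-cong {n} f≗g = cong sum (ListP.map-cong (cong b2n ∘ f≗g) (allPts n))

countPts-orbitwise : ∀ {n} (f : Pt n → Bool) (g : Fin n → ℕ) → (∀ s j → b2n (f (s , j)) ≡ g j) →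
  countPts f ≡ NatSum.sum g ℕ.+ NatSum.sum g
countPts-orbitwise f g fg = trans (countPts-split f)
  (cong₂ ℕ._+_ (NatSum.sum-cong-≗ (fg Sign.+)) (NatSum.sum-cong-≗ (fg Sign.-)))

Pt↔Fin : ∀ n → Pt n ↔ Fin (n ℕ.+ n)
Pt↔Fin n = ↔-trans Sign×↔⊎ (↔-sym FinP.+↔⊎)
  where
  Sign×↔⊎ : (Sign × Fin n) ↔ (Fin n ⊎ Fin n)
  Sign×↔⊎ = mk↔ₛ′ split [ (Sign.+ ,_) , (Sign.- ,_) ]′ split-join join-split
    where
    split : Sign × Fin n → Fin n ⊎ Fin n
    split (Sign.+ , j) = inj₁ j
    split (Sign.- , j) = inj₂ j
    split-join : ∀ x → split ([ (Sign.+ ,_) , (Sign.- ,_) ]′ x) ≡ x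
    split-join (inj₁ _) = refl
    split-join (inj₂ _) = refl
    join-split : ∀ p → [ (Sign.+ ,_) , (Sign.- ,_) ]′ (split p) ≡ p
    join-split (Sign.+ , _) = refl
    join-split (Sign.- , _) = refl

sum-halves : ∀ m {n} (F : Fin (m ℕ.+ n) → ℕ) →
  NatSum.sum F ≡ NatSum.sum (λ i → F (i ↑ˡ n)) ℕ.+ NatSum.sum (λ i → F (m ↑ʳ i))
sum-halves zero    F = refl
sum-halves (suc m) F = trans (cong (F zero ℕ.+_) (sum-halves m (F ∘ suc))) (sym (ℕP.+-assoc (F zero) _ _))

countPts-Fin : ∀ {n} (f : Pt n → Bool) → countPts f ≡ NatSum.sum (λ i → b2n (f (from (Pt↔Fin n) i)))
countPts-Fin {n} f = begin
  countPts f
    ≡⟨ countPts-split f ⟩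
  NatSum.sum (λ j → b2n (f (Sign.+ , j))) ℕ.+ NatSum.sum (λ j → b2n (f (Sign.- , j)))
    ≡⟨ cong₂ ℕ._+_ (NatSum.sum-cong-≗ λ j → cong (b2n ∘ f ∘ decode) (sym (FinP.splitAt-↑ˡ n j n)))
                   (NatSum.sum-cong-≗ λ j → cong (b2n ∘ f ∘ decode) (sym (FinP.splitAt-↑ʳ n n j))) ⟩
  NatSum.sum (λ j → F (j ↑ˡ n)) ℕ.+ NatSum.sum (λ j → F (n ↑ʳ j))
    ≡⟨ sum-halves n F ⟨
  NatSum.sum F ∎
  where
  decode : Fin n ⊎ Fin n → Pt n
  decode = [ (Sign.+ ,_) , (Sign.- ,_) ]′
  F : Fin (n ℕ.+ n) → ℕ
  F i = b2n (f (from (Pt↔Fin n) i))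

countPts-invariant : ∀ {n} (σ : Perm n) (f : Pt n → Bool) → countPts f ≡ countPts (f ∘ to σ)
countPts-invariant {n} σ f = begin
  countPts f                                     ≡⟨ countPts-Fin f ⟩
  NatSum.sum (λ i → b2n (f (from E i)))          ≡⟨ NatSum.sum-permute _ π ⟩
  NatSum.sum (λ i → b2n (f (from E (to E (to σ (from E i))))))
    ≡⟨ NatSum.sum-cong-≗ (λ i → cong (b2n ∘ f) (strictlyInverseʳ E (to σ (from E i)))) ⟩
  NatSum.sum (λ i → b2n (f (to σ (from E i))))   ≡⟨ countPts-Fin (f ∘ to σ) ⟨
  countPts (f ∘ to σ)                            ∎
  where
  E : Pt n ↔ Fin (n ℕ.+ n)
  E = Pt↔Fin n
  π : Fin (n ℕ.+ n) ↔ Fin (n ℕ.+ n)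
  π = ↔-trans (↔-sym E) (↔-trans σ E)


sumℤ≡∑ : ∀ {m} (f : Fin m → ℤ) → sumℤ f ≡ IntSum.sum f
sumℤ≡∑ {zero}  f = refl
sumℤ≡∑ {suc m} f = cong (_+_ (f zero)) (sumℤ≡∑ (f ∘ suc))

sumℤ-cong : ∀ {m} {f f′ : Fin m → ℤ} → (∀ l → f l ≡ f′ l) → sumℤ f ≡ sumℤ f′
sumℤ-cong {zero}  f≗f′ = refl
sumℤ-cong {suc m} f≗f′ = cong₂ _+_ (f≗f′ zero) (sumℤ-cong (f≗f′ ∘ suc))

∑-+ : ∀ {m} (g : Fin m → ℕ) → IntSum.sum (λ l → + g l) ≡ + NatSum.sum g
∑-+ {zero}  g = refl
∑-+ {suc m} g = cong (_+_ (+ g zero)) (∑-+ (g ∘ suc))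

∑≡0 : ∀ {m} (g : Fin m → ℕ) → NatSum.sum g ≡ 0 → ∀ l → g l ≡ 0
∑≡0 g sum≡0 zero    = ℕP.m+n≡0⇒m≡0 (g zero) sum≡0
∑≡0 g sum≡0 (suc l) = ∑≡0 (g ∘ suc) (ℕP.m+n≡0⇒n≡0 (g zero) sum≡0) l

ternary-balance : ∀ {c} → Ternary c → c + + b2n ⌊ c ℤ.≟ -1ℤ ⌋ ≡ + b2n ⌊ c ℤ.≟ 1ℤ ⌋
ternary-balance is0  = refl
ternary-balance is+1 = refl
ternary-balance is-1 = refl

zero-sum-balanced : ∀ {m} (c : Fin m → ℤ) → (∀ j → Ternary (c j)) → IntSum.sum c ≡ 0ℤ →
  NatSum.sum (λ j → b2n ⌊ c j ℤ.≟ 1ℤ ⌋) ≡ NatSum.sum (λ j → b2n ⌊ c j ℤ.≟ -1ℤ ⌋)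
zero-sum-balanced {m} c c-ternary ∑c≡0 = ℤP.+-injective (begin
  + NatSum.sum ones                                  ≡⟨ ∑-+ ones ⟨
  IntSum.sum (λ j → + ones j)                        ≡⟨ IntSum.sum-cong-≗ (λ j → ternary-balance (c-ternary j)) ⟨
  IntSum.sum (λ j → c j + + minusOnes j)             ≡⟨ IntSum.∑-distrib-+ c (λ j → + minusOnes j) ⟩
  IntSum.sum c + IntSum.sum (λ j → + minusOnes j)    ≡⟨ cong₂ _+_ ∑c≡0 (∑-+ minusOnes) ⟩
  0ℤ + + NatSum.sum minusOnes                        ≡⟨ ℤP.+-identityˡ _ ⟩
  + NatSum.sum minusOnes                             ∎)
  where
  ones minusOnes : Fin m → ℕ
  ones j = b2n ⌊ c j ℤ.≟ 1ℤ ⌋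
  minusOnes j = b2n ⌊ c j ℤ.≟ -1ℤ ⌋

δ-diag : ∀ {n} (i : Fin n) → δ i i ≡ 1ℤ
δ-diag i with i Fin.≟ i
... | yes _   = refl
... | no i≢i = contradiction refl i≢i

δ-off : ∀ {n} {i j : Fin n} → i ≢ j → δ i j ≡ 0ℤ
δ-off {i = i} {j} i≢j with i Fin.≟ j
... | yes i≡j = contradiction i≡j i≢j
... | no _    = refl

module _ {n k} {X : Mat n} (wX : IsWeighing n k X) where

  row-norm : ∀ i → IntSum.sum (λ l → X i l * X i l) ≡ + k
  row-norm i = begin
    IntSum.sum (λ l → X i l * X i l)  ≡⟨ sumℤ≡∑ (λ l → X i l * X i l) ⟨
    (X · (X ᵀ)) i i                   ≡⟨ proj₂ wX i i ⟩
    + k * δ i i                       ≡⟨ cong (+ k *_) (δ-diag i) ⟩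
    + k * 1ℤ                          ≡⟨ ℤP.*-identityʳ (+ k) ⟩
    + k                               ∎

  row-orthogonal : ∀ {a b} → a ≢ b → IntSum.sum (λ l → X a l * X b l) ≡ 0ℤ
  row-orthogonal {a} {b} a≢b = begin
    IntSum.sum (λ l → X a l * X b l)  ≡⟨ sumℤ≡∑ (λ l → X a l * X b l) ⟨
    (X · (X ᵀ)) a b                   ≡⟨ proj₂ wX a b ⟩
    + k * δ a b                       ≡⟨ cong (+ k *_) (δ-off a≢b) ⟩
    + k * 0ℤ                          ≡⟨ ℤP.*-zeroʳ (+ k) ⟩
    0ℤ                                ∎

  weight-zero : k ≡ 0 → ∀ i l → X i l ≡ 0ℤ
  weight-zero refl i l = ℤP.∣i∣≡0⇒i≡0 (∑≡0 (λ l → ℤ.∣ X i l ∣) (ℤP.+-injective ∑∣Xi∣≡0) l)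
    where
    square : ∀ {x} → Ternary x → x * x ≡ + ℤ.∣ x ∣
    square is0  = refl
    square is+1 = refl
    square is-1 = refl
    ∑∣Xi∣≡0 : + NatSum.sum (λ l → ℤ.∣ X i l ∣) ≡ 0ℤ
    ∑∣Xi∣≡0 = begin
      + NatSum.sum (λ l → ℤ.∣ X i l ∣)        ≡⟨ ∑-+ (λ l → ℤ.∣ X i l ∣) ⟨
      IntSum.sum (λ l → + ℤ.∣ X i l ∣)         ≡⟨ IntSum.sum-cong-≗ (λ l → square (proj₁ wX i l)) ⟨
      IntSum.sum (λ l → X i l * X i l)         ≡⟨ row-norm i ⟩
      0ℤ                                       ∎

  proportional-rows : k ≢ 0 → ∀ {a b} d d′ → (∀ l → sgnℤ d * X a l ≡ sgnℤ d′ * X b l) → a ≡ b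
  proportional-rows k≢0 {a} {b} d d′ agree with a Fin.≟ b
  ... | yes a≡b = a≡b
  ... | no a≢b  = contradiction (ℤP.+-injective k≡0) k≢0
    where
    scaled-weight≡0 : sgnℤ d′ * + k ≡ 0ℤ
    scaled-weight≡0 = begin
      sgnℤ d′ * + k                                   ≡⟨ cong (sgnℤ d′ *_) (row-norm b) ⟨
      sgnℤ d′ * IntSum.sum (λ l → X b l * X b l)      ≡⟨ IntSum.*-distribˡ-sum (sgnℤ d′) (λ l → X b l * X b l) ⟩
      IntSum.sum (λ l → sgnℤ d′ * (X b l * X b l))    ≡⟨ IntSum.sum-cong-≗ (λ l → ℤP.*-assoc (sgnℤ d′) (X b l) (X b l)) ⟨
      IntSum.sum (λ l → sgnℤ d′ * X b l * X b l)      ≡⟨ IntSum.sum-cong-≗ (λ l → cong (_* X b l) (agree l)) ⟨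
      IntSum.sum (λ l → sgnℤ d * X a l * X b l)       ≡⟨ IntSum.sum-cong-≗ (λ l → ℤP.*-assoc (sgnℤ d) (X a l) (X b l)) ⟩
      IntSum.sum (λ l → sgnℤ d * (X a l * X b l))     ≡⟨ IntSum.*-distribˡ-sum (sgnℤ d) (λ l → X a l * X b l) ⟨
      sgnℤ d * IntSum.sum (λ l → X a l * X b l)       ≡⟨ cong (sgnℤ d *_) (row-orthogonal a≢b) ⟩
      sgnℤ d * 0ℤ                                     ≡⟨ ℤP.*-zeroʳ (sgnℤ d) ⟩
      0ℤ                                              ∎
    k≡0 : + k ≡ 0ℤ
    k≡0 = begin
      + k                        ≡⟨ sgn-cancelˡ d′ (+ k) ⟨
      sgnℤ d′ * (sgnℤ d′ * + k)  ≡⟨ cong (sgnℤ d′ *_) scaled-weight≡0 ⟩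
      sgnℤ d′ * 0ℤ               ≡⟨ ℤP.*-zeroʳ (sgnℤ d′) ⟩
      0ℤ                         ∎


injective⇒surjective : ∀ {n} {f : Fin n → Fin n} → Injective _≡_ _≡_ f → ∀ y → ∃ λ x → f x ≡ y
injective⇒surjective {suc n} {f} f-injective y with FinP.any? (λ x → f x Fin.≟ y)
... | yes hit  = hit
... | no  miss = contradiction (FinP.injective⇒≤ squeeze-injective) ℕP.1+n≰n
  where
  -- f misses y, so it factors injectively through Fin n ≅ Fin (suc n) ∖ {y}
  avoids : ∀ x → y ≢ f x
  avoids x y≡fx = miss (x , sym y≡fx)
  squeeze : Fin (suc n) → Fin n
  squeeze x = Fin.punchOut (avoids x)
  squeeze-injective : Injective _≡_ _≡_ squeeze
  squeeze-injective eq = f-injective (FinP.punchOut-injective (avoids _) (avoids _) eq)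

signedPerm : ∀ {n} → (Fin n → Fin n) → (Fin n → Sign) → Mat n
signedPerm f e i l = if ⌊ f i Fin.≟ l ⌋ then sgnℤ (e i) else 0ℤ

signedPerm-monomial : ∀ {n} (f : Fin n → Fin n) (e : Fin n → Sign) → Injective _≡_ _≡_ f →
  IsSignedMonomial (signedPerm f e)
signedPerm-monomial f e f-injective = entries , rows , columns
  where
  nonzero⇒on-graph : ∀ i l → signedPerm f e i l ≢ 0ℤ → f i ≡ l
  nonzero⇒on-graph i l with f i Fin.≟ l
  ... | yes fi≡l = λ _ → fi≡l
  ... | no  _    = λ 0≢0 → contradiction refl 0≢0
  on-graph⇒nonzero : ∀ i → signedPerm f e i (f i) ≢ 0ℤ
  on-graph⇒nonzero i with f i Fin.≟ f i | e i
  ... | yes _ | Sign.+ = λ ()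
  ... | yes _ | Sign.- = λ ()
  ... | no fi≢fi | _   = contradiction refl fi≢fi
  entries : ∀ i l → Ternary (signedPerm f e i l)
  entries i l with ⌊ f i Fin.≟ l ⌋
  ... | true  = sgnℤ-ternary (e i)
  ... | false = is0
  rows : ∀ i → ∃ λ l → signedPerm f e i l ≢ 0ℤ × (∀ l′ → signedPerm f e i l′ ≢ 0ℤ → l′ ≡ l)
  rows i = f i , on-graph⇒nonzero i , λ l′ nz → sym (nonzero⇒on-graph i l′ nz)
  columns : ∀ l → ∃ λ i → signedPerm f e i l ≢ 0ℤ × (∀ i′ → signedPerm f e i′ l ≢ 0ℤ → i′ ≡ i)
  columns l with injective⇒surjective f-injective l
  ... | i , refl = i , on-graph⇒nonzero i , λ i′ nz → f-injective (nonzero⇒on-graph i′ (f i) nz)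

transpose-monomial : ∀ {n} {M : Mat n} → IsSignedMonomial M → IsSignedMonomial (M ᵀ)
transpose-monomial (entries , rows , columns) = (λ i j → entries j i) , columns , rows

pick : ∀ {n} (a : Fin n) (g : Fin n → ℤ) → sumℤ (λ l → if ⌊ a Fin.≟ l ⌋ then g l else 0ℤ) ≡ g a
pick {suc n} zero g = trans (cong (_+_ (g zero)) (rest-vanishes n)) (ℤP.+-identityʳ (g zero))
  where
  rest-vanishes : ∀ m → sumℤ {m} (λ _ → 0ℤ) ≡ 0ℤ
  rest-vanishes zero    = refl
  rest-vanishes (suc m) = trans (ℤP.+-identityˡ _) (rest-vanishes m)
pick {suc n} (suc a) g = trans (ℤP.+-identityˡ _) (trans (sumℤ-cong shift) (pick a (g ∘ suc)))
  where
  shift : ∀ l → (if ⌊ suc a Fin.≟ suc l ⌋ then g (suc l) else 0ℤ) ≡ (if ⌊ a Fin.≟ l ⌋ then g (suc l) else 0ℤ)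
  shift l with a Fin.≟ l
  ... | yes _ = refl
  ... | no  _ = refl

signed-permutation-equivalence : ∀ {n} {U W : Mat n}
  (r : Fin n → Fin n) → Injective _≡_ _≡_ r → (e : Fin n → Sign) →
  (h : Fin n → Fin n) → Injective _≡_ _≡_ h → (t : Fin n → Sign) →
  (∀ i j → U i j ≡ sgnℤ (e i) * W (r i) (h j) * sgnℤ (t j)) → MatEquiv U W
signed-permutation-equivalence {n} {W = W} r r-injective e h h-injective t u≡ewt =
  P , Q , signedPerm-monomial r e r-injective , transpose-monomial (signedPerm-monomial h t h-injective) ,
  λ i j → sym (trans (PW·Q i j) (trans (cong (_* sgnℤ (t j)) (P·W i (h j))) (sym (u≡ewt i j))))
  where
  P Q : Mat n
  P = signedPerm r e
  Q = signedPerm h t ᵀ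
  ifˡ : ∀ b (c x : ℤ) → (if b then c else 0ℤ) * x ≡ (if b then c * x else 0ℤ)
  ifˡ true  c x = refl
  ifˡ false c x = ℤP.*-zeroˡ x
  ifʳ : ∀ b (c x : ℤ) → x * (if b then c else 0ℤ) ≡ (if b then x * c else 0ℤ)
  ifʳ true  c x = refl
  ifʳ false c x = ℤP.*-zeroʳ x
  P·W : ∀ i j → (P · W) i j ≡ sgnℤ (e i) * W (r i) j
  P·W i j = trans (sumℤ-cong (λ l → ifˡ ⌊ r i Fin.≟ l ⌋ (sgnℤ (e i)) (W l j)))
                  (pick (r i) (λ l → sgnℤ (e i) * W l j))
  PW·Q : ∀ i j → ((P · W) · Q) i j ≡ (P · W) i (h j) * sgnℤ (t j)
  PW·Q i j = trans (sumℤ-cong (λ l → ifʳ ⌊ h j Fin.≟ l ⌋ (sgnℤ (t j)) ((P · W) i l)))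
                   (pick (h j) (λ l → (P · W) i l * sgnℤ (t j)))


carried : ∀ {n} (σ : Perm n) {B C : Blk n} → (B ^ σ) ≐ C → ∀ q → B q ≡ C (to σ q)
carried σ {B} B^σ≐C q = trans (cong B (sym (strictlyInverseʳ σ q))) (B^σ≐C (to σ q))

maps-inverse : ∀ {n} (σ : Perm n) {U W : Mat n} → MapsOnto σ U W → MapsOnto (↔-sym σ) W U
maps-inverse σ {U} {W} (forth , back) =
  (λ b′ → let (b , B≐) = back b′ in b , λ p → sym (carried σ {block U b} B≐ p)) ,
  (λ b → let (b′ , B≐) = forth b in b′ , λ p → sym (carried σ {block U b} B≐ p))

maps-compose : ∀ {n} (σ ρ : Perm n) {U V W : Mat n} →
  MapsOnto σ U V → MapsOnto ρ V W → MapsOnto (↔-trans σ ρ) U W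
maps-compose σ ρ (σ-forth , σ-back) (ρ-forth , ρ-back) =
  (λ b → let (c , B≐) = σ-forth b ; (d , C≐) = ρ-forth c in d , λ p → trans (B≐ (from ρ p)) (C≐ p)) ,
  (λ d → let (c , C≐) = ρ-back d ; (b , B≐) = σ-back c in b , λ p → trans (B≐ (from ρ p)) (C≐ p))

conjugate : ∀ {n} → Perm n → Perm n → Perm n
conjugate σ τ = ↔-trans (↔-sym σ) (↔-trans τ σ)

conjugate-aut : ∀ {n} (σ τ : Perm n) {U W : Mat n} → MapsOnto σ U W → IsAut U τ → IsAut W (conjugate σ τ)
conjugate-aut σ τ {U} {W} σ-maps τ-aut =
  maps-compose (↔-sym σ) (↔-trans τ σ) {W} {U} {W} (maps-inverse σ σ-maps) (maps-compose τ σ {U} {U} {W} τ-aut σ-maps)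

conjugate-fpf : ∀ {n} (σ : Perm n) {τ : Perm n} → FixedPointFreeInvolution τ →
  FixedPointFreeInvolution (conjugate σ τ)
conjugate-fpf σ {τ} (involutive , fixes-nothing) = involutive′ , fixes-nothing′
  where
  involutive′ : ∀ p → to σ (to τ (from σ (to σ (to τ (from σ p))))) ≡ p
  involutive′ p = begin
    to σ (to τ (from σ (to σ (to τ (from σ p)))))  ≡⟨ cong (to σ ∘ to τ) (strictlyInverseʳ σ _) ⟩
    to σ (to τ (to τ (from σ p)))                  ≡⟨ cong (to σ) (involutive (from σ p)) ⟩
    to σ (from σ p)                                ≡⟨ strictlyInverseˡ σ p ⟩
    p                                              ∎
  fixes-nothing′ : ∀ p → to σ (to τ (from σ p)) ≢ p
  fixes-nothing′ p fixed = fixes-nothing (from σ p) (trans (sym (strictlyInverseʳ σ _)) (cong (from σ) fixed))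

conjugate-condI : ∀ {n} (σ τ : Perm n) {U W : Mat n} → MapsOnto σ U W → CondI U τ → CondI W (conjugate σ τ)
conjugate-condI σ τ {U} {W} (_ , back) condI b p with back b
... | c , C≐ = subst₂ (λ x y → b2n x ℕ.+ b2n y ℕ.≤ 1) (C≐ p)
                 (carried σ {block U c} {block W b} C≐ (to τ (from σ p))) (condI c (from σ p))

-- The statistics of condition (ii) only read the memberships of the two points in the two blocks.
Local : ∀ {n} → (Blk n → Blk n → Pt n → Pt n → Bool) → Set
Local {n} φ = ∀ (B B′ C C′ : Blk n) (p q p′ q′ : Pt n) →
  B p ≡ C p′ → B′ p ≡ C′ p′ → B q ≡ C q′ → B′ q ≡ C′ q′ → φ B B′ p q ≡ φ C C′ p′ q′

cong₄ : ∀ (ψ : Bool → Bool → Bool → Bool → Bool) {x x′ y y′ z z′ w w′} →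
  x ≡ x′ → y ≡ y′ → z ≡ z′ → w ≡ w′ → ψ x y z w ≡ ψ x′ y′ z′ w′
cong₄ ψ refl refl refl refl = refl

sameNonempty-local : ∀ {n} → Local {n} sameNonempty
sameNonempty-local _ _ _ _ _ _ _ _ = cong₄ (λ x x′ y y′ → beq x x′ ∧ beq y y′ ∧ (x ∨ y))

diffNonempty-local : ∀ {n} → Local {n} diffNonempty
diffNonempty-local _ _ _ _ _ _ _ _ = cong₄ (λ x x′ y y′ → (x ∨ y) ∧ not (beq x x′ ∧ beq y y′) ∧ (x′ ∨ y′))

orbitCount-conjugate : ∀ {n} (σ τ : Perm n) (φ : Blk n → Blk n → Pt n → Pt n → Bool) → Local φ → ∀ {B B′ C C′ : Blk n} →
  (∀ q → C q ≡ B (to σ q)) → (∀ q → C′ q ≡ B′ (to σ q)) →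
  orbitCount (conjugate σ τ) (φ B B′) ≡ orbitCount τ (φ C C′)
orbitCount-conjugate σ τ φ φ-local {B} {B′} {C} {C′} C≡ C′≡ =
  cong (ℕ._/ 2) (trans (countPts-invariant σ _) (countPts-cong pointwise))
  where
  back-and-forth : ∀ q → to σ (to τ (from σ (to σ q))) ≡ to σ (to τ q)
  back-and-forth q = cong (to σ ∘ to τ) (strictlyInverseʳ σ q)
  pointwise : ∀ q → φ B B′ (to σ q) (to σ (to τ (from σ (to σ q)))) ≡ φ C C′ q (to τ q)
  pointwise q = φ-local B B′ C C′ (to σ q) (to σ (to τ (from σ (to σ q)))) q (to τ q) (sym (C≡ q)) (sym (C′≡ q))
    (trans (cong B (back-and-forth q)) (sym (C≡ (to τ q))))
    (trans (cong B′ (back-and-forth q)) (sym (C′≡ (to τ q))))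

conjugate-condII : ∀ {n} (σ τ : Perm n) {U W : Mat n} → MapsOnto σ U W → CondII U τ → CondII W (conjugate σ τ)
conjugate-condII σ τ {U} {W} (_ , back) condII b b′ b′≠b b′≠b^τ
  with back b | back b′
... | c , C≐ | c′ , C′≐ = begin
  orbitCount (conjugate σ τ) (sameNonempty (block W b) (block W b′))
    ≡⟨ orbitCount-conjugate σ τ sameNonempty sameNonempty-local {block W b} {block W b′} {block U c} {block U c′} Uc≡ Uc′≡ ⟩
  orbitCount τ (sameNonempty (block U c) (block U c′))
    ≡⟨ condII c c′ c′≠c c′≠c^τ ⟩
  orbitCount τ (diffNonempty (block U c) (block U c′))
    ≡⟨ orbitCount-conjugate σ τ diffNonempty diffNonempty-local {block W b} {block W b′} {block U c} {block U c′} Uc≡ Uc′≡ ⟨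
  orbitCount (conjugate σ τ) (diffNonempty (block W b) (block W b′)) ∎
  where
  Uc≡ : ∀ q → block U c q ≡ block W b (to σ q)
  Uc≡ = carried σ {block U c} {block W b} C≐
  Uc′≡ : ∀ q → block U c′ q ≡ block W b′ (to σ q)
  Uc′≡ = carried σ {block U c′} {block W b′} C′≐
  c′≠c : ¬ (block U c′ ≐ block U c)
  c′≠c eq = b′≠b (λ p → trans (sym (C′≐ p)) (trans (eq (from σ p)) (C≐ p)))
  c′≠c^τ : ¬ (block U c′ ≐ (block U c ^ τ))
  c′≠c^τ eq = b′≠b^τ (λ p → trans (sym (C′≐ p)) (trans (eq (from σ p)) (Uc≡ (from τ (from σ p)))))

conjugates-commute : ∀ {n} (σ ρ : Perm n) (t : Pt n → Pt n) →
  (∀ p → to σ (t (from σ p)) ≡ to ρ (t (from ρ p))) → ∀ q → from ρ (to σ (t q)) ≡ t (from ρ (to σ q))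
conjugates-commute σ ρ t same q = begin
  from ρ (to σ (t q))                  ≡⟨ cong (from ρ ∘ to σ ∘ t) (strictlyInverseʳ σ q) ⟨
  from ρ (to σ (t (from σ (to σ q))))  ≡⟨ cong (from ρ) (same (to σ q)) ⟩
  from ρ (to ρ (t (from ρ (to σ q))))  ≡⟨ strictlyInverseʳ ρ _ ⟩
  t (from ρ (to σ q))                  ∎


τ₀-fpf : ∀ {n} → FixedPointFreeInvolution (τ₀ {n})
τ₀-fpf = τ₀fun-involutive , λ (s , j) same → SignP.s≢opposite[s] s (sym (cong proj₁ same))

τ₀-aut : ∀ {n} (X : Mat n) → IsAut X τ₀
τ₀-aut X = (λ (i , ε) → (i , opposite ε) , block-τ₀ X i ε) ,
           (λ (i , ε) → (i , opposite ε) , λ p →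
             trans (block-τ₀ X i (opposite ε) p) (cong (λ ε′ → block X (i , ε′) p) (SignP.opposite-involutive ε)))

τ₀-condI : ∀ {n} (X : Mat n) → CondI X τ₀
τ₀-condI X (i , ε) (s , j) = hits-exclusive (sgnℤ ε * X i j) s

-- The statistics of (ii) on the τ₀-orbit {s·j, -s·j}, for blocks whose entries in column j are a, a′.
sameOnOrbit diffOnOrbit : ℤ → ℤ → Sign → Bool
sameOnOrbit a a′ s =
  beq (hits a s) (hits a′ s) ∧ beq (hits a (opposite s)) (hits a′ (opposite s)) ∧ (hits a s ∨ hits a (opposite s))
diffOnOrbit a a′ s =
  (hits a s ∨ hits a (opposite s)) ∧ not (beq (hits a s) (hits a′ s) ∧ beq (hits a (opposite s)) (hits a′ (opposite s)))
  ∧ (hits a′ s ∨ hits a′ (opposite s))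

orbit-profile : ∀ {a a′} → Ternary a → Ternary a′ → ∀ s →
  b2n (sameOnOrbit a a′ s) ≡ b2n ⌊ a * a′ ℤ.≟ 1ℤ ⌋ × b2n (diffOnOrbit a a′ s) ≡ b2n ⌊ a * a′ ℤ.≟ -1ℤ ⌋
orbit-profile is0  is0  Sign.+ = refl , refl
orbit-profile is0  is0  Sign.- = refl , refl
orbit-profile is0  is+1 Sign.+ = refl , refl
orbit-profile is0  is+1 Sign.- = refl , refl
orbit-profile is0  is-1 Sign.+ = refl , refl
orbit-profile is0  is-1 Sign.- = refl , refl
orbit-profile is+1 is0  Sign.+ = refl , refl
orbit-profile is+1 is0  Sign.- = refl , refl
orbit-profile is+1 is+1 Sign.+ = refl , refl
orbit-profile is+1 is+1 Sign.- = refl , refl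
orbit-profile is+1 is-1 Sign.+ = refl , refl
orbit-profile is+1 is-1 Sign.- = refl , refl
orbit-profile is-1 is0  Sign.+ = refl , refl
orbit-profile is-1 is0  Sign.- = refl , refl
orbit-profile is-1 is+1 Sign.+ = refl , refl
orbit-profile is-1 is+1 Sign.- = refl , refl
orbit-profile is-1 is-1 Sign.+ = refl , refl
orbit-profile is-1 is-1 Sign.- = refl , refl

-- Condition (ii) for τ₀ is the orthogonality of the rows of U.
τ₀-condII : ∀ {n k} {U : Mat n} → IsWeighing n k U → CondII U τ₀
τ₀-condII {n} {k} {U} wU (i , ε) (i′ , ε′) c′≠c c′≠c^τ₀ = cong (ℕ._/ 2) (begin
  countPts (λ q → sameNonempty (block U (i , ε)) (block U (i′ , ε′)) q (τ₀fun q))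
    ≡⟨ countPts-orbitwise _ agree agree-on-orbit ⟩
  NatSum.sum agree ℕ.+ NatSum.sum agree
    ≡⟨ cong (λ x → x ℕ.+ x) (zero-sum-balanced product (λ j → ternary-* (entry-ternary ε i j) (entry-ternary ε′ i′ j)) product-sum≡0) ⟩
  NatSum.sum disagree ℕ.+ NatSum.sum disagree
    ≡⟨ countPts-orbitwise _ disagree disagree-on-orbit ⟨
  countPts (λ q → diffNonempty (block U (i , ε)) (block U (i′ , ε′)) q (τ₀fun q)) ∎)
  where
  entry-ternary : ∀ ε i j → Ternary (sgnℤ ε * U i j)
  entry-ternary ε i j = ternary-* (sgnℤ-ternary ε) (proj₁ wU i j)
  product : Fin n → ℤ
  product j = sgnℤ ε * U i j * (sgnℤ ε′ * U i′ j)
  agree disagree : Fin n → ℕ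
  agree j = b2n ⌊ product j ℤ.≟ 1ℤ ⌋
  disagree j = b2n ⌊ product j ℤ.≟ -1ℤ ⌋
  agree-on-orbit : ∀ s j → b2n (sameOnOrbit (sgnℤ ε * U i j) (sgnℤ ε′ * U i′ j) s) ≡ agree j
  agree-on-orbit s j = proj₁ (orbit-profile (entry-ternary ε i j) (entry-ternary ε′ i′ j) s)
  disagree-on-orbit : ∀ s j → b2n (diffOnOrbit (sgnℤ ε * U i j) (sgnℤ ε′ * U i′ j) s) ≡ disagree j
  disagree-on-orbit s j = proj₂ (orbit-profile (entry-ternary ε i j) (entry-ternary ε′ i′ j) s)
  -- blocks of one row are equal or τ₀-images, so the two blocks lie in distinct rows
  i≢i′ : i ≢ i′
  i≢i′ refl = [ c′≠c , c′≠c^τ₀ ]′ (same-row-blocks U i ε ε′)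
  regroup : ∀ x y z w → x * y * (z * w) ≡ x * z * (y * w)
  regroup = solve-∀
  product-sum≡0 : IntSum.sum product ≡ 0ℤ
  product-sum≡0 = begin
    IntSum.sum product                                    ≡⟨ IntSum.sum-cong-≗ (λ j → regroup (sgnℤ ε) (U i j) (sgnℤ ε′) (U i′ j)) ⟩
    IntSum.sum (λ j → sgnℤ ε * sgnℤ ε′ * (U i j * U i′ j)) ≡⟨ IntSum.*-distribˡ-sum (sgnℤ ε * sgnℤ ε′) (λ j → U i j * U i′ j) ⟨
    sgnℤ ε * sgnℤ ε′ * IntSum.sum (λ j → U i j * U i′ j)  ≡⟨ cong (sgnℤ ε * sgnℤ ε′ *_) (row-orthogonal {k = k} wU i≢i′) ⟩
    sgnℤ ε * sgnℤ ε′ * 0ℤ                                  ≡⟨ ℤP.*-zeroʳ (sgnℤ ε * sgnℤ ε′) ⟩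
    0ℤ                                                     ∎


module ColumnAction {n} (f : Pt n → Pt n) (f-τ₀ : ∀ q → f (τ₀fun q) ≡ τ₀fun (f q)) where

  twist : Fin n → Sign
  twist j = proj₁ (f (Sign.+ , j))

  column : Fin n → Fin n
  column j = proj₂ (f (Sign.+ , j))

  acts-columnwise : ∀ s j → f (s , j) ≡ (s Sign.* twist j , column j)
  acts-columnwise Sign.+ j = refl
  acts-columnwise Sign.- j = f-τ₀ (Sign.+ , j)

  -- Two columns with the same image would force f (+ , j′) to be f (± , j).
  column-injective : Injective _≡_ _≡_ f → Injective _≡_ _≡_ column
  column-injective f-injective {j} {j′} same with sign-dichotomy (twist j) (twist j′)
  ... | inj₁ t′≡t = cong proj₂ (f-injective (begin
    f (Sign.+ , j)         ≡⟨ acts-columnwise Sign.+ j ⟩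
    (twist j , column j)   ≡⟨ cong₂ _,_ (sym t′≡t) same ⟩
    (twist j′ , column j′) ≡⟨ acts-columnwise Sign.+ j′ ⟨
    f (Sign.+ , j′)        ∎))
  ... | inj₂ t′≡-t = contradiction (cong proj₁ (f-injective (begin
    f (Sign.+ , j′)                  ≡⟨ acts-columnwise Sign.+ j′ ⟩
    (twist j′ , column j′)           ≡⟨ cong₂ _,_ t′≡-t (sym same) ⟩
    (opposite (twist j) , column j)  ≡⟨ acts-columnwise Sign.- j ⟨
    f (Sign.- , j)                   ∎))) λ ()

to-injective : ∀ {n} (σ : Perm n) → Injective _≡_ _≡_ (to σ)
to-injective σ {x} {y} same = trans (sym (strictlyInverseʳ σ x)) (trans (cong (from σ) same) (strictlyInverseʳ σ y))

-- If π : D(U) → D(W) commutes with τ₀, then U ≅ W: π sends the block B_i^+ of U to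
-- some block B_{r(i)}^{e(i)} of W, which reads u_ij = e_i w_{r(i) h(j)} t_j.
τ₀-compatible⇒equivalent : ∀ {n k′} {U W : Mat n} → IsWeighing n k′ U → (∀ i j → Ternary (W i j)) → k′ ≢ 0 →
  (π : Perm n) → MapsOnto π U W → (∀ q → to π (τ₀fun q) ≡ τ₀fun (to π q)) → MatEquiv U W
τ₀-compatible⇒equivalent {n} {k′} {U} {W} wU W-ternary k′≢0 π (forth , _) π-τ₀ =
  signed-permutation-equivalence r r-injective e column (column-injective (to-injective π)) twist u≡ewt
  where
  open ColumnAction (to π) π-τ₀
  r : Fin n → Fin n
  r i = proj₁ (proj₁ (forth (i , Sign.+)))
  e : Fin n → Sign
  e i = proj₂ (proj₁ (forth (i , Sign.+)))
  u≡ewt : ∀ i j → U i j ≡ sgnℤ (e i) * W (r i) (column j) * sgnℤ (twist j)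
  u≡ewt i j = trans (sym (ℤP.*-identityˡ (U i j))) (hits-determines
    (ternary-* (sgnℤ-ternary Sign.+) (proj₁ wU i j))
    (ternary-* (ternary-* (sgnℤ-ternary (e i)) (W-ternary (r i) (column j))) (sgnℤ-ternary (twist j)))
    λ s → begin
      block U (i , Sign.+) (s , j)                             ≡⟨ carried π {block U (i , Sign.+)} {block W (r i , e i)} (proj₂ (forth (i , Sign.+))) (s , j) ⟩
      block W (r i , e i) (to π (s , j))                        ≡⟨ cong (block W (r i , e i)) (acts-columnwise s j) ⟩
      hits (sgnℤ (e i) * W (r i) (column j)) (s Sign.* twist j) ≡⟨ hits-shift _ s (twist j) ⟩
      hits (sgnℤ (e i) * W (r i) (column j) * sgnℤ (twist j)) s ∎)
  -- rows i, i′ with r i = r i′ agree up to signs, so they coincide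
  r-injective : Injective _≡_ _≡_ r
  r-injective {i} {i′} same = proportional-rows {k = k′} wU k′≢0 (e i) (e i′) λ l → begin
    sgnℤ (e i) * U i l                        ≡⟨ unsign (e i) (u≡ewt i l) ⟩
    W (r i) (column l) * sgnℤ (twist l)       ≡⟨ cong (λ m → W m (column l) * sgnℤ (twist l)) same ⟩
    W (r i′) (column l) * sgnℤ (twist l)      ≡⟨ unsign (e i′) (u≡ewt i′ l) ⟨
    sgnℤ (e i′) * U i′ l                      ∎


empty-blocks⇒zero : ∀ {n} {X : Mat n} → (∀ i j → Ternary (X i j)) →
  (∀ i p → block X (i , Sign.+) p ≡ false) → ∀ i j → X i j ≡ 0ℤ
empty-blocks⇒zero {X = X} X-ternary empty i j = trans (sym (ℤP.*-identityˡ (X i j)))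
  (hits-determines (ternary-* (sgnℤ-ternary Sign.+) (X-ternary i j)) is0 λ s → trans (empty i (s , j)) (nothing-hits-0 s))
  where
  nothing-hits-0 : ∀ s → false ≡ hits 0ℤ s
  nothing-hits-0 Sign.+ = refl
  nothing-hits-0 Sign.- = refl

zero⇒empty-blocks : ∀ {n} {X : Mat n} → (∀ i j → X i j ≡ 0ℤ) → ∀ b p → block X b p ≡ false
zero⇒empty-blocks {X = X} X-zero (i , ε) (s , j) = trans (cong (λ x → hits (sgnℤ ε * x) s) (X-zero i j)) (misses ε s)
  where
  misses : ∀ ε s → hits (sgnℤ ε * 0ℤ) s ≡ false
  misses Sign.+ Sign.+ = refl
  misses Sign.+ Sign.- = refl
  misses Sign.- Sign.+ = refl
  misses Sign.- Sign.- = refl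

zero-equivalent : ∀ {n} {U W : Mat n} → (∀ i j → U i j ≡ 0ℤ) → (∀ i j → W i j ≡ 0ℤ) → MatEquiv U W
zero-equivalent U-zero W-zero = signed-permutation-equivalence id id (λ _ → Sign.+) id id (λ _ → Sign.+)
  λ i j → trans (U-zero i j) (sym (cong (λ x → 1ℤ * x * 1ℤ) (W-zero i j)))

-- If U has weight 0, then U = 0, all blocks of D(U) are empty, hence so are those of D(W).
weight-zero⇒equivalent : ∀ {n} {U W : Mat n} → (∀ i j → Ternary (W i j)) → (∀ i j → U i j ≡ 0ℤ) →
  (σ : Perm n) → MapsOnto σ U W → MatEquiv U W
weight-zero⇒equivalent {U = U} {W} W-ternary U-zero σ (_ , back) =
  zero-equivalent U-zero (empty-blocks⇒zero W-ternary W-empty)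
  where
  W-empty : ∀ i p → block W (i , Sign.+) p ≡ false
  W-empty i p with back (i , Sign.+)
  ... | c , C≐ = trans (sym (C≐ p)) (zero⇒empty-blocks U-zero c (from σ p))


lemma3p3 : ∀ {n k : ℕ} (W : Mat n) → IsWeighing n k W →
    (∀ (τ : Perm n) → FixedPointFreeInvolution τ → IsAut W τ →
       CondI W τ → CondII W τ → ConjugateToτ₀ W τ) →
    ∀ {k′ : ℕ} (U : Mat n) → IsWeighing n k′ U → DEquiv U W → MatEquiv U W
lemma3p3 {n} W wW hypothesis {k′} U wU (σ , σ-maps) with k′ ℕ.≟ 0
... | yes k′≡0 = weight-zero⇒equivalent (proj₁ wW) (weight-zero {k = k′} wU k′≡0) σ σ-maps
... | no k′≢0 = τ₀-compatible⇒equivalent wU (proj₁ wW) k′≢0 π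
  (maps-compose σ (↔-sym ρ) {U} {W} {W} σ-maps (maps-inverse ρ ρ-aut)) (conjugates-commute σ ρ τ₀fun τ≡ρτ₀ρ⁻¹)
  where
  -- τ = σ τ₀ σ⁻¹ satisfies the hypothesis, since τ₀ does on D(U)
  τ : Perm n
  τ = conjugate σ τ₀
  conjugacy : ConjugateToτ₀ W τ
  conjugacy = hypothesis τ (conjugate-fpf σ {τ₀} τ₀-fpf) (conjugate-aut σ τ₀ σ-maps (τ₀-aut U))
    (conjugate-condI σ τ₀ σ-maps (τ₀-condI U)) (conjugate-condII σ τ₀ σ-maps (τ₀-condII {k = k′} wU))
  ρ : Perm n
  ρ = proj₁ conjugacy
  ρ-aut : IsAut W ρ
  ρ-aut = proj₁ (proj₂ conjugacy)
  τ≡ρτ₀ρ⁻¹ : ∀ p → to τ p ≡ to ρ (τ₀fun (from ρ p))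
  τ≡ρτ₀ρ⁻¹ = proj₂ (proj₂ conjugacy)
  π : Perm n
  π = ↔-trans σ (↔-sym ρ)
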